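{- Let $n\ge2$ and $m\ge1$. Then $\operatorname{ecc}_{Z_{n,m}}(0)\ge\lfloor\frac{n(m+1)}{2}\rfloor$, where $\operatorname{ecc}_{Z_{n,m}}(0)$ is the maximum graph distance in $Z_{n,m}$ from the all-zero vertex $0$ to a vertex.
   Context: Elements of $\mathbb{Z}_n$ are identified with their smallest nonnegative representatives in $\{0,\dots,n-1\}$. The dYoke graph $Z_{n,m}$ has as vertices all tuples $u=(u_0,\dots,u_{m+1})$ with $u_0,u_{m+1}\in\mathbb{Z}_n$, $u_1,\dots,u_m\in\{ -1,0,1\}$ and $\sum_{i=0}^{m+1}u_i\equiv0\pmod n$; adjacency: there is $0\le i\le m$ with $u_j=v_j$ for $j\notin\{i,i+1\}$ and either ($u_i=v_i+1$, $u_{i+1}=v_{i+1}-1$) or ($u_i=v_i-1$, $u_{i+1}=v_{i+1}+1$), arithmetic in coordinates $0,m+1$ in $\mathbb{Z}_n$. -}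

module Defs where

open import Data.Nat as ℕ using (ℕ; zero; suc)
open import Data.Fin using (Fin; zero; suc; toℕ; inject₁; fromℕ)
open import Data.Integer as ℤ using (ℤ; +_; _-_; -[1+_])
open import Data.Integer.Divisibility using (_∣_)
open import Data.Product using (Σ; _×_)
open import Data.Sum using (_⊎_)
open import Relation.Binary.PropositionalEquality using (_≡_; _≢_; refl; subst; sym)
open import Data.Product using (_,_)
open import Data.Sum using (inj₁; inj₂)
import Data.Nat.Divisibility as ℕDiv

-- A tuple (u_0, …, u_{m+1}) is a function Fin (m+2) → ℤ.
Tuple : ℕ → Set
Tuple m = Fin (suc (suc m)) → ℤ

sumℤ : ∀ {k} → (Fin k → ℤ) → ℤ
sumℤ {zero}  f = + 0
sumℤ {suc k} f = f zero ℤ.+ sumℤ (λ j → f (suc j))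

first : ∀ {m} → Fin (suc (suc m))
first = zero

last : ∀ m → Fin (suc (suc m))
last m = fromℕ (suc m)

IsTrit : ℤ → Set
IsTrit x = (x ≡ -[1+ 0 ]) ⊎ (x ≡ + 0) ⊎ (x ≡ + 1)

-- End coordinates are elements of ℤ_n, represented by 0..n-1.
InZn : ℕ → ℤ → Set
InZn n x = Σ ℕ (λ k → (x ≡ + k) × (k ℕ.< n))

Valid : ℕ → (m : ℕ) → Tuple m → Set
Valid n m u =
  InZn n (u first) × InZn n (u (last m))
  × (∀ (i : Fin m) → IsTrit (u (suc (inject₁ i))))
  × ((+ n) ∣ sumℤ u)

Vertex : ℕ → ℕ → Set
Vertex n m = Σ (Tuple m) (Valid n m)

CoordEq : ℕ → (m : ℕ) → Fin (suc (suc m)) → ℤ → ℤ → Set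
CoordEq n m j x y =
  ((j ≡ first ⊎ j ≡ last m) × ((+ n) ∣ (x - y)))
  ⊎ ((j ≢ first × j ≢ last m) × x ≡ y)

Step : ℕ → (m : ℕ) → Fin (suc m) → Tuple m → Tuple m → Set
Step n m i u v =
  (∀ j → j ≢ inject₁ i → j ≢ suc i → u j ≡ v j)
  × CoordEq n m (inject₁ i) (u (inject₁ i)) (v (inject₁ i) ℤ.+ + 1)
  × CoordEq n m (suc i) (u (suc i)) (v (suc i) - + 1)

Adj : ∀ n m → Vertex n m → Vertex n m → Set
Adj n m (u , _) (v , _) = Σ (Fin (suc m)) (λ i → Step n m i u v ⊎ Step n m i v u)


data Walk (n m : ℕ) : Vertex n m → Vertex n m → ℕ → Set where
  nil  : ∀ {u} → Walk n m u u zero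
  cons : ∀ {u v w k} → Adj n m u v → Walk n m v w k → Walk n m u w (suc k)

-- graph distance d(u,v) ≥ k  iff  no walk from u to v of length < k
-- (with d = ∞ if there is no walk at all)
DistGE : ∀ n m → Vertex n m → Vertex n m → ℕ → Set
DistGE n m u v k = ∀ ℓ → ℓ ℕ.< k → Walk n m u v ℓ → ⊥
  where open import Data.Empty using (⊥)

-- the all-zero vertex (needs n ≥ 1 so that 0 ∈ {0,…,n-1})
sumℤ-zero : ∀ k → sumℤ {k} (λ _ → + 0) ≡ + 0
sumℤ-zero zero = refl
sumℤ-zero (suc k) rewrite sumℤ-zero k = refl

zeroV : ∀ n m → 1 ℕ.≤ n → Vertex n m
zeroV n m 1≤n = (λ _ → + 0)
  , (0 , refl , 1≤n) , (0 , refl , 1≤n) , (λ _ → inj₂ (inj₁ refl))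
  , subst ((+ n) ∣_) (sym (sumℤ-zero (suc (suc m)))) (n ℕDiv.∣0)

EccGE : ∀ n m → Vertex n m → ℕ → Set
EccGE n m u k = Σ (Vertex n m) (λ v → DistGE n m u v k)

2≤⇒1≤ : ∀ {n} → 2 ℕ.≤ n → 1 ℕ.≤ n
2≤⇒1≤ (ℕ.s≤s _) = ℕ.s≤s ℕ.z≤n

module Submission where

-- A *lift* of a vertex u is an integer tuple û that equals u in the middle coordinates
-- and is congruent to u modulo n at the two end coordinates.  The *potential* of û is
-- the sum |S₀| + |S₁| + … of the absolute values of its prefix sums S_j = û₀ + … + û_j.
--
-- 1. An edge of Z_{n,m} moves one unit between coordinates i and i+1 (modulo n at the
--    ends).  Applying the same move to a lift of one endpoint gives a lift of the other,
--    and the move changes only the prefix sum S_i, by ±1; so the potential changes by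
--    at most 1.  Along a walk of length ℓ the potential thus grows by at most ℓ.
-- 2. The zero tuple lifts the zero vertex and has potential 0.
-- 3. Write n = r + (r + e) with e ∈ {0,1}.  The target vertex is (r, e, -e, e, …, L),
--    with L ∈ ℤ_n chosen so the coordinates sum to n.  In any lift, the first entry t
--    satisfies t ≡ r (mod n), whence |t| ≥ r and |t| + |t + e| ≥ n; its prefix sums
--    alternate t, t+e, t, …, so the potential is at least n(m+1)/2 up to rounding.

open import Defs
open import Data.Nat using (ℕ; _≤_; _*_; _/_; zero; suc; s≤s)
import Data.Nat as ℕ
import Data.Nat.Properties as ℕP
import Data.Nat.Divisibility as ℕDiv
open import Data.Nat.DivMod using (_%_; m≡m%n+[m/n]*n; m%n<n; m≥n⇒m/n>0; m<n*o⇒m/o<n)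
import Data.Nat.Tactic.RingSolver as ℕSolver
open import Data.Fin using (Fin; zero; suc; inject₁; fromℕ)
open import Data.Fin.Properties using (suc-injective; fromℕ≢inject₁) renaming (_≟_ to _≟ᶠ_)
open import Data.Integer as ℤ using (ℤ; +_; -[1+_]; ∣_∣; _+_; _-_; -_)
import Data.Integer.Properties as ℤP
import Data.Integer.Divisibility as ℤDiv
import Data.Integer.Divisibility.Signed as ℤDivˢ
open import Data.Integer.Tactic.RingSolver using (solve-∀)
open import Data.Product using (Σ; _×_; _,_; proj₁; proj₂)
open import Data.Sum using (_⊎_; inj₁; inj₂; swap)
open import Data.Empty using (⊥-elim)
open import Relation.Binary.PropositionalEquality
open import Relation.Nullary using (¬_; yes; no)

_≡_[mod_] : ℤ → ℤ → ℕ → Set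
x ≡ y [mod n ] = + n ℤDiv.∣ (x - y)

mod-refl : ∀ n x → x ≡ x [mod n ]
mod-refl n x = subst (+ n ℤDiv.∣_) (sym (ℤP.+-inverseʳ x)) (n ℕDiv.∣0)

mod-sym : ∀ {n x y} → x ≡ y [mod n ] → y ≡ x [mod n ]
mod-sym {n} {x} {y} = subst (n ℕDiv.∣_) (ℤP.∣i-j∣≡∣j-i∣ x y)

mod-trans : ∀ {n x y z} → x ≡ y [mod n ] → y ≡ z [mod n ] → x ≡ z [mod n ]
mod-trans {n} {x} {y} {z} x≡y y≡z =
  ℤDivˢ.∣⇒∣ᵤ {+ n} {x - z} (subst (ℤDivˢ._∣_ (+ n)) (telescope x y z)
    (ℤDivˢ.∣m∣n⇒∣m+n (ℤDivˢ.∣ᵤ⇒∣ {+ n} {x - y} x≡y) (ℤDivˢ.∣ᵤ⇒∣ {+ n} {y - z} y≡z)))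
  where
  telescope : ∀ x y z → (x - y) + (y - z) ≡ x - z
  telescope = solve-∀

module _ {n m : ℕ} where

  end-not-middle : ∀ {j} → (j ≡ first ⊎ j ≡ last m) → ¬ (j ≢ first × j ≢ last m)
  end-not-middle (inj₁ j≡first) (j≢first , _) = j≢first j≡first
  end-not-middle (inj₂ j≡last)  (_ , j≢last)  = j≢last j≡last

  coordEq-refl : ∀ j x → CoordEq n m j x x
  coordEq-refl j x with j ≟ᶠ first | j ≟ᶠ last m
  ... | yes j≡first | _          = inj₁ (inj₁ j≡first , mod-refl n x)
  ... | no _        | yes j≡last = inj₁ (inj₂ j≡last , mod-refl n x)
  ... | no j≢first  | no j≢last  = inj₂ ((j≢first , j≢last) , refl)

  coordEq-reflexive : ∀ {j x y} → x ≡ y → CoordEq n m j x y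
  coordEq-reflexive {j} {x} x≡y = subst (CoordEq n m j x) x≡y (coordEq-refl j x)

  coordEq-sym : ∀ {j x y} → CoordEq n m j x y → CoordEq n m j y x
  coordEq-sym {x = x} {y} (inj₁ (end , x≡y)) = inj₁ (end , mod-sym {n} {x} {y} x≡y)
  coordEq-sym (inj₂ (mid , x≡y)) = inj₂ (mid , sym x≡y)

  coordEq-trans : ∀ {j x y z} → CoordEq n m j x y → CoordEq n m j y z → CoordEq n m j x z
  coordEq-trans {x = x} {y} {z} (inj₁ (end , x≡y)) (inj₁ (_ , y≡z)) =
    inj₁ (end , mod-trans {n} {x} {y} {z} x≡y y≡z)
  coordEq-trans (inj₂ (mid , x≡y)) (inj₂ (_ , y≡z))   = inj₂ (mid , trans x≡y y≡z)
  coordEq-trans (inj₁ (end , _))   (inj₂ (mid , _))   = ⊥-elim (end-not-middle end mid)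
  coordEq-trans (inj₂ (mid , _))   (inj₁ (end , _))   = ⊥-elim (end-not-middle end mid)

  coordEq-shift : ∀ {j x y} c → CoordEq n m j x y → CoordEq n m j (x + c) (y + c)
  coordEq-shift {x = x} {y} c (inj₁ (end , x≡y)) =
    inj₁ (end , subst (+ n ℤDiv.∣_) (difference-invariant x y c) x≡y)
    where
    difference-invariant : ∀ x y c → x - y ≡ (x + c) - (y + c)
    difference-invariant = solve-∀
  coordEq-shift c (inj₂ (mid , x≡y)) = inj₂ (mid , cong (_+ c) x≡y)

  coordEq-middle : ∀ {x y} (j : Fin m) → CoordEq n m (suc (inject₁ j)) x y → x ≡ y
  coordEq-middle j (inj₁ (inj₁ () , _))
  coordEq-middle j (inj₁ (inj₂ j≡last , _)) = ⊥-elim (fromℕ≢inject₁ (sym (suc-injective j≡last)))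
  coordEq-middle j (inj₂ (_ , x≡y)) = x≡y

  coordEq-first : ∀ {x y} → CoordEq n m first x y → x ≡ y [mod n ]
  coordEq-first (inj₁ (_ , x≡y))            = x≡y
  coordEq-first (inj₂ ((≢first , _) , _)) = ⊥-elim (≢first refl)

-- unitMove i: moving one unit from position i+1 to position i adds this vector
-- (+1 at inject₁ i, -1 at suc i, 0 elsewhere).
unitMove : ∀ {k} → Fin k → Fin (suc k) → ℤ
unitMove zero    zero          = + 1
unitMove zero    (suc zero)    = -[1+ 0 ]
unitMove zero    (suc (suc j)) = + 0
unitMove (suc i) zero          = + 0
unitMove (suc i) (suc j)       = unitMove i j

unitMove-source : ∀ {k} (i : Fin k) → unitMove i (inject₁ i) ≡ + 1
unitMove-source zero    = refl
unitMove-source (suc i) = unitMove-source i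

unitMove-target : ∀ {k} (i : Fin k) → unitMove i (suc i) ≡ -[1+ 0 ]
unitMove-target zero    = refl
unitMove-target (suc i) = unitMove-target i

unitMove-elsewhere : ∀ {k} (i : Fin k) j → j ≢ inject₁ i → j ≢ suc i → unitMove i j ≡ + 0
unitMove-elsewhere zero    zero          j≢i _    = ⊥-elim (j≢i refl)
unitMove-elsewhere zero    (suc zero)    _   j≢i+1 = ⊥-elim (j≢i+1 refl)
unitMove-elsewhere zero    (suc (suc j)) _   _    = refl
unitMove-elsewhere (suc i) zero          _   _    = refl
unitMove-elsewhere (suc i) (suc j)       j≢i j≢i+1 =
  unitMove-elsewhere i j (λ j≡i → j≢i (cong suc j≡i)) (λ j≡i+1 → j≢i+1 (cong suc j≡i+1))

step-displacement : ∀ {n m i u v} → Step n m i u v →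
  ∀ j → CoordEq n m j (u j) (v j + unitMove i j)
step-displacement {n} {m} {i} {u} {v} (unchanged , at-source , at-target) j
  with j ≟ᶠ inject₁ i | j ≟ᶠ suc i
... | yes refl | _ =
  subst (CoordEq n m j (u j)) (cong (λ d → v j + d) (sym (unitMove-source i))) at-source
... | no _ | yes refl =
  subst (CoordEq n m j (u j)) (cong (λ d → v j + d) (sym (unitMove-target i))) at-target
... | no j≢i | no j≢i+1 = coordEq-reflexive (begin
  u j                      ≡⟨ unchanged j j≢i j≢i+1 ⟩
  v j                      ≡⟨ ℤP.+-identityʳ (v j) ⟨
  v j + + 0                ≡⟨ cong (λ d → v j + d) (unitMove-elsewhere i j j≢i j≢i+1) ⟨
  v j + unitMove i j       ∎)
  where open ≡-Reasoning

prefixCost : ∀ {k} → ℤ → (Fin k → ℤ) → ℕ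
prefixCost {zero}  a w = ∣ a ∣
prefixCost {suc k} a w = ∣ a ∣ ℕ.+ prefixCost (a + w zero) (λ j → w (suc j))

prefixCost-cong : ∀ {k a b} {v w : Fin k → ℤ} → a ≡ b → (∀ j → v j ≡ w j) →
  prefixCost a v ≡ prefixCost b w
prefixCost-cong {zero}  refl _   = refl
prefixCost-cong {suc k} {a} refl v≗w =
  cong (∣ a ∣ ℕ.+_) (prefixCost-cong (cong (λ q → a + q) (v≗w zero)) (λ j → v≗w (suc j)))

prefixCost-zero : ∀ k → prefixCost {k} (+ 0) (λ _ → + 0) ≡ 0
prefixCost-zero zero    = refl
prefixCost-zero (suc k) = prefixCost-zero k

untouched : ∀ w c → w + c ℤ.* + 0 ≡ w
untouched = solve-∀

-- Performing c moves at i changes only the i-th prefix sum, by c; so the cost grows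
-- by at most |c|.
transfer-cost : ∀ {k} (i : Fin k) c a (w : Fin (suc k) → ℤ) →
  prefixCost a (λ j → w j + c ℤ.* unitMove i j) ≤ prefixCost a w ℕ.+ ∣ c ∣
transfer-cost {suc k} zero c a w = begin
  ∣ a ∣ ℕ.+ (∣ a + (w zero + c ℤ.* + 1) ∣ ℕ.+ rest′)
    ≡⟨ cong₂ (λ p q → ∣ a ∣ ℕ.+ (∣ p ∣ ℕ.+ q)) (moved-sum a (w zero) c)
         (prefixCost-cong (untouched-acc a (w zero) (w (suc zero)) c)
           (λ j → untouched (w (suc (suc j))) c)) ⟩
  ∣ a ∣ ℕ.+ (∣ (a + w zero) + c ∣ ℕ.+ rest)
    ≤⟨ ℕP.+-monoʳ-≤ (∣ a ∣) (ℕP.+-monoˡ-≤ rest (ℤP.∣i+j∣≤∣i∣+∣j∣ (a + w zero) c)) ⟩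
  ∣ a ∣ ℕ.+ ((∣ a + w zero ∣ ℕ.+ ∣ c ∣) ℕ.+ rest)
    ≡⟨ rearrange (∣ a ∣) (∣ a + w zero ∣) (∣ c ∣) rest ⟩
  (∣ a ∣ ℕ.+ (∣ a + w zero ∣ ℕ.+ rest)) ℕ.+ ∣ c ∣ ∎
  where
  open ℕP.≤-Reasoning
  rest′ rest : ℕ
  rest′ = prefixCost ((a + (w zero + c ℤ.* + 1)) + (w (suc zero) + c ℤ.* -[1+ 0 ]))
                     (λ j → w (suc (suc j)) + c ℤ.* + 0)
  rest  = prefixCost ((a + w zero) + w (suc zero)) (λ j → w (suc (suc j)))
  moved-sum : ∀ a w c → a + (w + c ℤ.* + 1) ≡ (a + w) + c
  moved-sum = solve-∀
  untouched-acc : ∀ a w₀ w₁ c →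
    (a + (w₀ + c ℤ.* + 1)) + (w₁ + c ℤ.* -[1+ 0 ]) ≡ (a + w₀) + w₁
  untouched-acc = solve-∀
  rearrange : ∀ p q c r → p ℕ.+ ((q ℕ.+ c) ℕ.+ r) ≡ (p ℕ.+ (q ℕ.+ r)) ℕ.+ c
  rearrange = ℕSolver.solve-∀
transfer-cost (suc i) c a w = begin
  ∣ a ∣ ℕ.+ prefixCost (a + (w zero + c ℤ.* + 0)) (λ j → w (suc j) + c ℤ.* unitMove i j)
    ≡⟨ cong (λ s → ∣ a ∣ ℕ.+ prefixCost (a + s) (λ j → w (suc j) + c ℤ.* unitMove i j))
            (untouched (w zero) c) ⟩
  ∣ a ∣ ℕ.+ prefixCost (a + w zero) (λ j → w (suc j) + c ℤ.* unitMove i j)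
    ≤⟨ ℕP.+-monoʳ-≤ (∣ a ∣) (transfer-cost i c (a + w zero) (λ j → w (suc j))) ⟩
  ∣ a ∣ ℕ.+ (prefixCost (a + w zero) (λ j → w (suc j)) ℕ.+ ∣ c ∣)
    ≡⟨ ℕP.+-assoc (∣ a ∣) _ (∣ c ∣) ⟨
  (∣ a ∣ ℕ.+ prefixCost (a + w zero) (λ j → w (suc j))) ℕ.+ ∣ c ∣ ∎
  where open ℕP.≤-Reasoning

Lift : ∀ n m → Tuple m → Tuple m → Set
Lift n m û u = ∀ j → CoordEq n m j (û j) (u j)

potential : ∀ {m} → Tuple m → ℕ
potential û = prefixCost (+ 0) û

displace-lift : ∀ {n m} {x y x̂ d : Tuple m} →
  (∀ j → CoordEq n m j (x j + d j) (y j)) → Lift n m x̂ x →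
  Lift n m (λ j → x̂ j + d j) y
displace-lift {d = d} displaced lift j = coordEq-trans (coordEq-shift (d j) (lift j)) (displaced j)

edge-lift : ∀ {n m A B} → Adj n m A B → ∀ {â} → Lift n m â (proj₁ A) →
  Σ (Tuple m) λ b̂ → Lift n m b̂ (proj₁ B) × potential b̂ ≤ potential â ℕ.+ 1
edge-lift {n} {m} {u , _} {v , _} (i , inj₁ step) {â} lift =
  _ , displace-lift forward lift , transfer-cost i -[1+ 0 ] (+ 0) â
  where
  cancel : ∀ v d → (v + d) + -[1+ 0 ] ℤ.* d ≡ v
  cancel = solve-∀
  forward : ∀ j → CoordEq n m j (u j + -[1+ 0 ] ℤ.* unitMove i j) (v j)
  forward j = subst (CoordEq n m j _) (cancel (v j) (unitMove i j))
    (coordEq-shift (-[1+ 0 ] ℤ.* unitMove i j) (step-displacement step j))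
edge-lift {n} {m} {u , _} {v , _} (i , inj₂ step) {â} lift =
  _ , displace-lift backward lift , transfer-cost i (+ 1) (+ 0) â
  where
  backward : ∀ j → CoordEq n m j (u j + + 1 ℤ.* unitMove i j) (v j)
  backward j = subst (λ d → CoordEq n m j (u j + d) (v j)) (sym (ℤP.*-identityˡ (unitMove i j)))
    (coordEq-sym (step-displacement step j))

walk-lift : ∀ {n m A B ℓ} → Walk n m A B ℓ → ∀ {â} → Lift n m â (proj₁ A) →
  Σ (Tuple m) λ b̂ → Lift n m b̂ (proj₁ B) × potential b̂ ≤ potential â ℕ.+ ℓ
walk-lift nil {â} lift = â , lift , ℕP.m≤m+n (potential â) 0
walk-lift {A = A} {ℓ = suc ℓ} (cons {v = W} edge walk) {â} lift with edge-lift {A = A} {B = W} edge lift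
... | ŵ , lift-ŵ , edge-cost with walk-lift walk lift-ŵ
... | b̂ , lift-b̂ , walk-cost = b̂ , lift-b̂ , (begin
  potential b̂                   ≤⟨ walk-cost ⟩
  potential ŵ ℕ.+ ℓ             ≤⟨ ℕP.+-monoˡ-≤ ℓ edge-cost ⟩
  (potential â ℕ.+ 1) ℕ.+ ℓ     ≡⟨ ℕP.+-assoc (potential â) 1 ℓ ⟩
  potential â ℕ.+ suc ℓ         ∎)
  where open ℕP.≤-Reasoning

zigzag : ∀ k → ℤ → ℤ → ℤ → Fin (suc k) → ℤ
zigzag zero    x y z zero    = z
zigzag (suc k) x y z zero    = x
zigzag (suc k) x y z (suc j) = zigzag k y x z j

zigzagSum : ℕ → ℤ → ℤ → ℤ
zigzagSum zero    x y = + 0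
zigzagSum (suc k) x y = x + zigzagSum k y x

zigzag-last : ∀ k {x y z} → zigzag k x y z (fromℕ k) ≡ z
zigzag-last zero    = refl
zigzag-last (suc k) = zigzag-last k

zigzag-middle : ∀ k {x y z} (j : Fin k) → zigzag k x y z (inject₁ j) ≡ x ⊎ zigzag k x y z (inject₁ j) ≡ y
zigzag-middle (suc k) zero    = inj₁ refl
zigzag-middle (suc k) (suc j) = swap (zigzag-middle k j)

sum-zigzag : ∀ k {x y z} → sumℤ (zigzag k x y z) ≡ zigzagSum k x y + z
sum-zigzag zero    {z = z}     = ℤP.+-comm z (+ 0)
sum-zigzag (suc k) {x} {y} {z} =
  trans (cong (λ q → x + q) (sum-zigzag k)) (sym (ℤP.+-assoc x (zigzagSum k y x) z))

zigzagSum-cases : ∀ k {x y} → x + y ≡ + 0 → zigzagSum k x y ≡ + 0 ⊎ zigzagSum k x y ≡ x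
zigzagSum-cases zero    _ = inj₁ refl
zigzagSum-cases (suc k) {x} {y} x+y≡0 with zigzagSum-cases k (trans (ℤP.+-comm y x) x+y≡0)
... | inj₁ s≡0 = inj₂ (trans (cong (λ q → x + q) s≡0) (ℤP.+-identityʳ x))
... | inj₂ s≡y = inj₁ (trans (cong (λ q → x + q) s≡y) x+y≡0)

-- Cost of a sequence whose first k entries zigzag between x and -x: its prefix sums
-- alternate t, t+x, t, …, so two consecutive ones contribute ≥ N, a single one ≥ (N-1)/2.
zigzag-cost : ∀ k {N : ℕ} {x y z : ℤ} (t : ℤ) (w : Fin (suc k) → ℤ) →
  x + y ≡ + 0 → N ≤ suc (∣ t ∣ * 2) → N ≤ ∣ t ∣ ℕ.+ ∣ t + x ∣ →
  (∀ j → w (inject₁ j) ≡ zigzag k x y z (inject₁ j)) →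
  N * suc k ≤ suc (prefixCost t w * 2)
zigzag-cost zero {N} t w _ single _ _ = begin
  N * 1                                   ≡⟨ ℕP.*-identityʳ N ⟩
  N                                       ≤⟨ single ⟩
  suc (∣ t ∣ * 2)                         ≤⟨ s≤s (ℕP.*-monoˡ-≤ 2 (ℕP.m≤m+n (∣ t ∣) _)) ⟩
  suc ((∣ t ∣ ℕ.+ ∣ t + w zero ∣) * 2)    ∎
  where open ℕP.≤-Reasoning
zigzag-cost (suc zero) {N} t w _ _ pair zigzags = begin
  N * 2                                   ≤⟨ ℕP.*-monoˡ-≤ 2 pair ⟩
  (∣ t ∣ ℕ.+ ∣ t + _ ∣) * 2               ≡⟨ cong (λ w₀ → (∣ t ∣ ℕ.+ ∣ t + w₀ ∣) * 2) (zigzags zero) ⟨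
  (∣ t ∣ ℕ.+ ∣ t + w zero ∣) * 2          ≤⟨ ℕP.*-monoˡ-≤ 2 (ℕP.+-monoʳ-≤ (∣ t ∣) (ℕP.m≤m+n _ _)) ⟩
  prefixCost t w * 2                      ≤⟨ ℕP.n≤1+n _ ⟩
  suc (prefixCost t w * 2)                ∎
  where open ℕP.≤-Reasoning
zigzag-cost (suc (suc k)) {N} {x} {y} t w x+y≡0 single pair zigzags = begin
  N * suc (suc (suc k))                   ≡⟨ split N k ⟩
  N * 2 ℕ.+ N * suc k                     ≤⟨ ℕP.+-mono-≤ (ℕP.*-monoˡ-≤ 2 pair) rest-cost ⟩
  (∣ t ∣ ℕ.+ ∣ t + x ∣) * 2 ℕ.+ suc (rest * 2)
                                          ≡⟨ merge (∣ t ∣) (∣ t + x ∣) rest ⟩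
  suc ((∣ t ∣ ℕ.+ (∣ t + x ∣ ℕ.+ rest)) * 2)
                                          ≡⟨ cong (λ c → suc (c * 2)) unfold ⟨
  suc (prefixCost t w * 2)                ∎
  where
  open ℕP.≤-Reasoning
  rest : ℕ
  rest = prefixCost t (λ j → w (suc (suc j)))
  rest-cost : N * suc k ≤ suc (rest * 2)
  rest-cost = zigzag-cost k t (λ j → w (suc (suc j))) x+y≡0 single pair (λ j → zigzags (suc (suc j)))
  back-to-t : (t + w zero) + w (suc zero) ≡ t
  back-to-t = trans (cong₂ (λ p q → (t + p) + q) (zigzags zero) (zigzags (suc zero)))
    (trans (ℤP.+-assoc t x y) (trans (cong (λ q → t + q) x+y≡0) (ℤP.+-identityʳ t)))
  unfold : prefixCost t w ≡ ∣ t ∣ ℕ.+ (∣ t + x ∣ ℕ.+ rest)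
  unfold = cong₂ (λ w₀ c → ∣ t ∣ ℕ.+ (∣ t + w₀ ∣ ℕ.+ c)) (zigzags zero)
             (cong (λ s → prefixCost s (λ j → w (suc (suc j)))) back-to-t)
  split : ∀ N k → N * suc (suc (suc k)) ≡ N * 2 ℕ.+ N * suc k
  split = ℕSolver.solve-∀
  merge : ∀ a b c → (a ℕ.+ b) * 2 ℕ.+ suc (c * 2) ≡ suc ((a ℕ.+ (b ℕ.+ c)) * 2)
  merge = ℕSolver.solve-∀

-- If t ≡ r (mod n) with n = r + (r + e), then |t| ≥ r and |t| + |t + e| ≥ n:
-- either t = r, or |t - r| ≥ n, which forces |t| ≥ r + e and |t + e| ≥ r.
near-residue : ∀ {n r e} t → n ≡ r ℕ.+ (r ℕ.+ e) → t ≡ + r [mod n ] →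
  r ≤ ∣ t ∣ × n ≤ ∣ t ∣ ℕ.+ ∣ t + + e ∣
near-residue {n} {r} {e} t n≡ t≡r with t ℤP.≟ + r
... | yes refl = ℕP.≤-refl , ℕP.≤-reflexive n≡
... | no t≢r = ℕP.≤-trans (ℕP.m≤m+n r e) r+e≤∣t∣ ,
    ℕP.≤-trans (ℕP.≤-reflexive n≡′) (ℕP.+-mono-≤ r+e≤∣t∣ r≤∣t+e∣)
  where
  n≡′ : n ≡ (r ℕ.+ e) ℕ.+ r
  n≡′ = trans n≡ (ℕP.+-comm r (r ℕ.+ e))
  far : n ≤ ∣ t - + r ∣
  far = ℕDiv.∣⇒≤ {{ℕ.≢-nonZero (λ d≡0 → t≢r (ℤP.i-j≡0⇒i≡j t (+ r) (ℤP.∣i∣≡0⇒i≡0 d≡0)))}} t≡r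
  shifted : ∀ t r e → t - r ≡ (t + e) - (r + e)
  shifted = solve-∀
  r+e≤∣t∣ : r ℕ.+ e ≤ ∣ t ∣
  r+e≤∣t∣ = ℕP.+-cancelʳ-≤ r (r ℕ.+ e) (∣ t ∣)
    (subst (_≤ ∣ t ∣ ℕ.+ r) n≡′ (ℕP.≤-trans far (ℤP.∣i-j∣≤∣i∣+∣j∣ t (+ r))))
  r≤∣t+e∣ : r ≤ ∣ t + + e ∣
  r≤∣t+e∣ = ℕP.+-cancelʳ-≤ (r ℕ.+ e) r (∣ t + + e ∣)
    (subst (_≤ ∣ t + + e ∣ ℕ.+ (r ℕ.+ e)) n≡
      (ℕP.≤-trans far (subst (λ d → ∣ d ∣ ≤ ∣ t + + e ∣ ℕ.+ (r ℕ.+ e)) (sym (shifted t (+ r) (+ e)))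
        (ℤP.∣i-j∣≤∣i∣+∣j∣ (t + + e) (+ (r ℕ.+ e))))))

sign-trit : ∀ {e x} → e ≤ 1 → x ≡ + e ⊎ x ≡ - + e → IsTrit x
sign-trit {zero}  _ (inj₁ x≡0)  = inj₂ (inj₁ x≡0)
sign-trit {zero}  _ (inj₂ x≡0)  = inj₂ (inj₁ x≡0)
sign-trit {suc zero} _ (inj₁ x≡1)  = inj₂ (inj₂ x≡1)
sign-trit {suc zero} _ (inj₂ x≡-1) = inj₁ x≡-1
sign-trit {suc (suc _)} (s≤s ()) _

module Target (n m r e : ℕ) (n≡ : n ≡ r ℕ.+ (r ℕ.+ e)) (e≤1 : e ≤ 1) (1≤r : 1 ≤ r) where

  -- the last coordinate, chosen so that the coordinates sum to exactly n
  closing : ℤ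
  closing = + (r ℕ.+ e) - zigzagSum m (+ e) (- + e)

  tuple : Tuple m
  tuple zero    = + r
  tuple (suc j) = zigzag m (+ e) (- + e) closing j

  r+e<n : r ℕ.+ e ℕ.< n
  r+e<n = subst (suc (r ℕ.+ e) ≤_) (sym n≡) (ℕP.+-monoˡ-≤ (r ℕ.+ e) 1≤r)

  r<n : r ℕ.< n
  r<n = ℕP.≤-<-trans (ℕP.m≤m+n r e) r+e<n

  closing-in-range : InZn n closing
  closing-in-range with zigzagSum-cases m {+ e} (ℤP.+-inverseʳ (+ e))
  ... | inj₁ s≡0 = r ℕ.+ e , trans (cong (λ s → + (r ℕ.+ e) - s) s≡0) (ℤP.+-identityʳ _) , r+e<n
  ... | inj₂ s≡e = r , trans (cong (λ s → + (r ℕ.+ e) - s) s≡e) (drop-e (+ r) (+ e)) , r<n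
    where
    drop-e : ∀ a b → (a + b) - b ≡ a
    drop-e = solve-∀

  sum-is-n : sumℤ tuple ≡ + n
  sum-is-n = begin
    + r + sumℤ (zigzag m (+ e) (- + e) closing)  ≡⟨ cong (λ q → + r + q) (sum-zigzag m) ⟩
    + r + (s + (+ (r ℕ.+ e) - s))                ≡⟨ cancel-s (+ r) s (+ (r ℕ.+ e)) ⟩
    + (r ℕ.+ (r ℕ.+ e))                          ≡⟨ cong +_ n≡ ⟨
    + n                                          ∎
    where
    open ≡-Reasoning
    s : ℤ
    s = zigzagSum m (+ e) (- + e)
    cancel-s : ∀ a s b → a + (s + (b - s)) ≡ a + b
    cancel-s = solve-∀

  vertex : Vertex n m
  vertex = tuple , (r , refl , r<n)
         , subst (InZn n) (sym (zigzag-last m)) closing-in-range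
         , (λ j → sign-trit e≤1 (zigzag-middle m j))
         , subst (+ n ℤDiv.∣_) (sym sum-is-n) ℕDiv.∣-refl

  cost-bound : ∀ {V̂} → Lift n m V̂ tuple → n * suc m ≤ suc (potential V̂ * 2)
  cost-bound {V̂} lift = subst (λ c → n * suc m ≤ suc (c * 2)) (sym potential≡)
    (zigzag-cost m t (λ j → V̂ (suc j)) (ℤP.+-inverseʳ (+ e)) single pair
      (λ j → coordEq-middle j (lift (suc (inject₁ j)))))
    where
    t : ℤ
    t = V̂ zero
    residue : r ≤ ∣ t ∣ × n ≤ ∣ t ∣ ℕ.+ ∣ t + + e ∣
    residue = near-residue t n≡ (coordEq-first (lift zero))
    r≤∣t∣ : r ≤ ∣ t ∣
    r≤∣t∣ = proj₁ residue
    single : n ≤ suc (∣ t ∣ * 2)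
    single = begin
      n                             ≡⟨ n≡ ⟩
      r ℕ.+ (r ℕ.+ e)               ≤⟨ ℕP.+-mono-≤ r≤∣t∣ (ℕP.+-mono-≤ r≤∣t∣ e≤1) ⟩
      ∣ t ∣ ℕ.+ (∣ t ∣ ℕ.+ 1)       ≡⟨ double (∣ t ∣) ⟩
      suc (∣ t ∣ * 2)               ∎
      where
      open ℕP.≤-Reasoning
      double : ∀ a → a ℕ.+ (a ℕ.+ 1) ≡ suc (a * 2)
      double = ℕSolver.solve-∀
    pair : n ≤ ∣ t ∣ ℕ.+ ∣ t + + e ∣
    pair = proj₂ residue
    potential≡ : potential V̂ ≡ prefixCost t (λ j → V̂ (suc j))
    potential≡ = cong (λ s → prefixCost s (λ j → V̂ (suc j))) (ℤP.+-identityˡ t)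

lemma5p16 : (n m : ℕ) → (n≥2 : 2 ≤ n) → 1 ≤ m →
    EccGE n m (zeroV n m (2≤⇒1≤ n≥2)) ((n * suc m) / 2)
lemma5p16 n m n≥2 _ = vertex , far-from-zero
  where
  r e : ℕ
  r = n / 2
  e = n % 2
  n≡ : n ≡ r ℕ.+ (r ℕ.+ e)
  n≡ = trans (m≡m%n+[m/n]*n n 2) (halves e r)
    where
    halves : ∀ e r → e ℕ.+ r * 2 ≡ r ℕ.+ (r ℕ.+ e)
    halves = ℕSolver.solve-∀
  open Target n m r e n≡ (ℕP.≤-pred (m%n<n n 2)) (m≥n⇒m/n>0 n≥2)

  -- A walk of length ℓ from 0 carries the zero lift (potential 0) to a lift of the far
  -- vertex of potential ≤ ℓ, so n(m+1) ≤ 2ℓ + 1.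
  far-from-zero : DistGE n m (zeroV n m (2≤⇒1≤ n≥2)) vertex ((n * suc m) / 2)
  far-from-zero ℓ ℓ<half walk with walk-lift walk {λ _ → + 0} (λ j → coordEq-refl j (+ 0))
  ... | V̂ , lift , cost = ℕP.<⇒≱ ℓ<half (ℕP.≤-pred (m<n*o⇒m/o<n (s≤s n[m+1]≤2ℓ+1)))
    where
    n[m+1]≤2ℓ+1 : n * suc m ≤ suc (ℓ * 2)
    n[m+1]≤2ℓ+1 = ℕP.≤-trans (cost-bound lift)
      (s≤s (ℕP.*-monoˡ-≤ 2 (subst (λ p → potential V̂ ≤ p ℕ.+ ℓ) (prefixCost-zero (suc (suc m))) cost)))
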